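{- Let $P$ be a finite poset with set of edges $E=\{(x,y): x\lessdot y\}$, and let $\lambda:E\to\mathbb{Z}$ be an injective U-labeling. Let $A$ be an abelian group and $f:P\to A$. Consider the straight-line program that first sets $g(x)\leftarrow f(x)$ for all $x\in P$ and then, for each edge $(x,y)\in E$ in increasing order of $\lambda$, executes $g(y)\leftarrow g(y)+g(x)$. Its output satisfies $g(y)=\sum_{x\le y}f(x)$ for every $y\in P$ (i.e. it computes the zeta transform of $f$). Moreover, given $g:P\to A$, the straight-line program that first sets $f(x)\leftarrow g(x)$ for all $x\in P$ and then, for each edge $(x,y)\in E$ in decreasing order of $\lambda$, executes $f(y)\leftarrow f(y)-f(x)$, computes the Möbius transform of $g$, i.e. the unique $f:P\to A$ with $g(y)=\sum_{x\le y}f(x)$ for all $y$.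
   Context: $x\lessdot y$ means $y$ covers $x$ ($x<y$ with nothing strictly between). An edge labeling is a map $\lambda:E\to\mathbb{Z}$. An unrefinable chain from $x$ to $y$ is a sequence $x=x_0\lessdot x_1\lessdot\cdots\lessdot x_m=y$; it is rising if $\lambda(x_0,x_1)\le\lambda(x_1,x_2)\le\cdots\le\lambda(x_{m-1},x_m)$. A labeling $\lambda$ is a U-labeling (labeling with unique rising chains) if for every pair $x\le y$ in $P$ there is exactly one rising unrefinable chain from $x$ to $y$. -}

module Defs where

open import Level using (Level)
open import Data.Nat using (ℕ)
open import Data.Fin using (Fin; _≟_)
open import Data.Fin.Base using ()
open import Data.Integer using (ℤ) renaming (_≤_ to _≤ℤ_; _<_ to _<ℤ_)
open import Data.List using (List; []; _∷_; foldl; foldr; reverse; allFin)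
open import Data.List.Membership.Propositional using (_∈_)
open import Data.List.Relation.Unary.Linked using (Linked)
open import Data.Product using (Σ; ∃; _×_; _,_; proj₁; proj₂)
open import Data.Unit using (⊤)
open import Data.Empty using (⊥)
open import Data.Bool using (if_then_else_)
open import Relation.Nullary using (¬_; does)
open import Relation.Binary.Core using (Rel)
open import Relation.Binary.Definitions using (Decidable)
open import Relation.Binary.PropositionalEquality using (_≡_)
open import Algebra.Bundles using (AbelianGroup)

-- Throughout: a finite poset is Fin n with a (decidable) partial order _≤_
-- (stated against _≡_ via IsPartialOrder in the statement).

module _ {n : ℕ} (_≤_ : Rel (Fin n) Level.zero) where

  _<_ : Rel (Fin n) Level.zero
  x < y = (x ≤ y) × ¬ (x ≡ y)

  _⋖_ : Rel (Fin n) Level.zero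
  x ⋖ y = (x < y) × (∀ z → x < z → ¬ (z < y))

  data Chain : Fin n → Fin n → Set where
    nil  : ∀ {x} → Chain x x
    cons : ∀ {x y z} → x ⋖ y → Chain y z → Chain x z

  -- vertex sequence of a chain (chains are identified by their vertices)
  vertices : ∀ {x y} → Chain x y → List (Fin n)
  vertices {x} nil = x ∷ []
  vertices {x} (cons _ c) = x ∷ vertices c

  module _ (lab : Fin n → Fin n → ℤ) where
    -- the edge labeling λ is given by its values lab x y on the edges x ⋖ y
    Rising : ∀ {x y} → Chain x y → Set
    Rising nil = ⊤
    Rising (cons _ nil) = ⊤
    Rising (cons {x} {y} _ (cons {_} {z} q c)) =
      (lab x y ≤ℤ lab y z) × Rising (cons q c)

    IsULabeling : Set
    IsULabeling = ∀ x y → x ≤ y →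
      Σ (Chain x y) λ c → Rising c ×
        (∀ (c' : Chain x y) → Rising c' → vertices c' ≡ vertices c)

    InjectiveOnEdges : Set
    InjectiveOnEdges = ∀ x y x' y' → x ⋖ y → x' ⋖ y' →
      lab x y ≡ lab x' y' → (x ≡ x') × (y ≡ y')

    IsEdgeOrder : List (Fin n × Fin n) → Set
    IsEdgeOrder es =
      (∀ {x y} → (x , y) ∈ es → x ⋖ y) ×
      (∀ x y → x ⋖ y → (x , y) ∈ es) ×
      Linked (λ e e' → lab (proj₁ e) (proj₂ e) <ℤ lab (proj₁ e') (proj₂ e')) es

module _ {c ℓ : Level} (A : AbelianGroup c ℓ) {n : ℕ} where
  open AbelianGroup A

  zetaStep : (Fin n → Carrier) → Fin n × Fin n → (Fin n → Carrier)
  zetaStep g (x , y) z = if does (z ≟ y) then g y ∙ g x else g z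

  mobiusStep : (Fin n → Carrier) → Fin n × Fin n → (Fin n → Carrier)
  mobiusStep f (x , y) z = if does (z ≟ y) then f y ∙ (f x ⁻¹) else f z

  zetaProgram : List (Fin n × Fin n) → (Fin n → Carrier) → (Fin n → Carrier)
  zetaProgram es f = foldl zetaStep f es

  mobiusProgram : List (Fin n × Fin n) → (Fin n → Carrier) → (Fin n → Carrier)
  mobiusProgram es g = foldl mobiusStep g (reverse es)

  sumBelow : {_≤_ : Rel (Fin n) Level.zero} → Decidable _≤_ →
             (Fin n → Carrier) → Fin n → Carrier
  sumBelow _≤?_ f y =
    foldr (λ x acc → if does (x ≤? y) then f x ∙ acc else acc) ε (allFin n)

module Submission where

-- For a list `done` of edges write  x ↝ y  (inside `done`) when there is a
-- rising unrefinable chain from x to y all of whose edges lie in `done`.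
-- The invariant of the zeta program is: after the edges `done` have been
-- processed, g(y) = Σ_{x ↝ y} f(x).  Initially done = [] and x ↝ y iff
-- x = y.  Processing an edge u ⋖ v whose label exceeds all labels in `done`
-- changes reachability only at v, where the new rising chains are exactly
-- the rising chains to u extended by u ⋖ v; these are disjoint from the old
-- chains to v by uniqueness of rising chains.  So g(v) ← g(v) + g(u)
-- preserves the invariant.  Once every edge is processed, x ↝ y iff x ≤ y
-- (U-labeling), which is the zeta transform.  The Möbius program is inverted
-- step by step by the zeta program, whence the Möbius statement.

open import Defs
open import Level using (Level; 0ℓ)
open import Data.Nat using (ℕ; suc)
open import Data.Fin using (Fin; _≟_; punchIn)
open import Data.Fin.Properties using (punchInᵢ≢i)
open import Data.Integer using (ℤ) renaming (_≤_ to _≤ℤ_; _<_ to _<ℤ_)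
import Data.Integer.Properties as ℤ
open import Data.List using (List; []; _∷_; foldl; foldr; tabulate; _ʳ++_)
open import Data.List.Properties using (foldl-ʳ++)
open import Data.List.Membership.Propositional using (_∈_)
open import Data.List.Relation.Unary.Any using (here; there)
open import Data.List.Relation.Unary.Any.Properties using (reverseAcc⁺)
open import Data.List.Relation.Unary.All as All using (All; _∷_)
open import Data.List.Relation.Unary.AllPairs using (AllPairs; _∷_)
open import Data.List.Relation.Unary.Linked using (Linked; [-]; _∷_; linked?)
open import Data.List.Relation.Unary.Linked.Properties using (Linked⇒AllPairs)
open import Data.Product using (Σ; _×_; _,_; proj₁; proj₂)
open import Data.Product.Properties using (≡-dec)
open import Data.Sum using (_⊎_; inj₁; inj₂; [_,_])
open import Data.Unit using (⊤; tt)
open import Data.Empty using (⊥-elim)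
open import Data.Bool using (if_then_else_)
open import Function using (_∘_; id)
open import Relation.Nullary using (¬_; Dec; yes; no; does)
open import Relation.Nullary.Decidable using (map′; dec-true; dec-false)
open import Relation.Binary.Core using (Rel)
open import Relation.Binary.Definitions using (Decidable)
open import Relation.Binary.Structures using (IsPartialOrder; IsPreorder)
open import Relation.Binary.PropositionalEquality
  using (_≡_; _≢_; refl; sym; trans; cong; cong₂; subst)
open import Algebra.Bundles using (AbelianGroup; CommutativeMonoid)

Edge : ℕ → Set
Edge n = Fin n × Fin n

module IndicatorSums {a ℓ} (M : CommutativeMonoid a ℓ) where
  open CommutativeMonoid M renaming (refl to ≈-refl; sym to ≈-sym; trans to ≈-trans)
  open import Algebra.Properties.CommutativeMonoid.Sum M
    using (sum; sum-syntax; sum-cong-≋; ∑-distrib-+) public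
  open import Algebra.Properties.CommutativeMonoid.Sum M
    using (sum-remove; sum-replicate-zero)
  open import Relation.Binary.Reasoning.Setoid setoid

  [_]·_ : ∀ {p} {P : Set p} → Dec P → Carrier → Carrier
  [ P? ]· x = if does P? then x else ε

  indicator-yes : ∀ {p} {P : Set p} (P? : Dec P) {x} → P → [ P? ]· x ≈ x
  indicator-yes (yes _) _ = ≈-refl
  indicator-yes (no ¬p) p = ⊥-elim (¬p p)

  indicator-no : ∀ {p} {P : Set p} (P? : Dec P) {x} → ¬ P → [ P? ]· x ≈ ε
  indicator-no (yes p) ¬p = ⊥-elim (¬p p)
  indicator-no (no _) _ = ≈-refl

  indicator-cong : ∀ {p q} {P : Set p} {Q : Set q} (P? : Dec P) (Q? : Dec Q) {x} →
    (P → Q) → (Q → P) → [ P? ]· x ≈ [ Q? ]· x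
  indicator-cong (yes p) Q? P⇒Q _ = ≈-sym (indicator-yes Q? (P⇒Q p))
  indicator-cong (no ¬p) Q? _ Q⇒P = ≈-sym (indicator-no Q? (¬p ∘ Q⇒P))

  indicator-disjoint : ∀ {p q s} {P : Set p} {Q : Set q} {S : Set s}
    (S? : Dec S) (P? : Dec P) (Q? : Dec Q) {x} →
    (S → P ⊎ Q) → (P ⊎ Q → S) → (Q → ¬ P) → [ S? ]· x ≈ [ P? ]· x ∙ [ Q? ]· x
  indicator-disjoint S? P? (yes q) S⇒ ⇒S disj = begin
    [ S? ]· _            ≈⟨ indicator-yes S? (⇒S (inj₂ q)) ⟩
    _                    ≈⟨ ≈-sym (identityˡ _) ⟩
    ε ∙ _                ≈⟨ ∙-congʳ (≈-sym (indicator-no P? (disj q))) ⟩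
    [ P? ]· _ ∙ _        ∎
  indicator-disjoint S? P? (no ¬q) S⇒ ⇒S _ = begin
    [ S? ]· _            ≈⟨ indicator-cong S? P? ([ id , ⊥-elim ∘ ¬q ] ∘ S⇒) (⇒S ∘ inj₁) ⟩
    [ P? ]· _            ≈⟨ ≈-sym (identityʳ _) ⟩
    [ P? ]· _ ∙ ε        ∎

  sum-concentrated : ∀ {m} (t : Fin m → Carrier) (y : Fin m) →
    (∀ x → x ≢ y → t x ≈ ε) → sum t ≈ t y
  sum-concentrated {suc m} t y vanish = begin
    sum t                              ≈⟨ sum-remove t ⟩
    t y ∙ sum (t ∘ punchIn y)          ≈⟨ ∙-congˡ (≈-trans (sum-cong-≋ rest≈ε) (sum-replicate-zero m)) ⟩
    t y ∙ ε                            ≈⟨ identityʳ _ ⟩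
    t y                                ∎
    where
    rest≈ε : ∀ j → t (punchIn y j) ≈ ε
    rest≈ε j = vanish (punchIn y j) (punchInᵢ≢i y j)

  filtered-fold : ∀ {b p} {B : Set b} {P : B → Set p} (P? : ∀ x → Dec (P x))
    (f : B → Carrier) {m} (h : Fin m → B) →
    foldr (λ x acc → if does (P? x) then f x ∙ acc else acc) ε (tabulate h)
      ≈ ∑[ i < m ] [ P? (h i) ]· f (h i)
  filtered-fold P? f {0} h = ≈-refl
  filtered-fold P? f {suc m} h with P? (h Fin.zero)
  ... | yes _ = ∙-congˡ (filtered-fold P? f (h ∘ Fin.suc))
  ... | no _ = ≈-trans (filtered-fold P? f (h ∘ Fin.suc)) (≈-sym (identityˡ _))

module Chains {n : ℕ} (_≤_ : Rel (Fin n) 0ℓ) where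

  ⋖⇒≢ : ∀ {x y} → _⋖_ _≤_ x y → x ≢ y
  ⋖⇒≢ x⋖y = proj₂ (proj₁ x⋖y)

  chain⇒≤ : IsPreorder _≡_ _≤_ → ∀ {x y} → Chain _≤_ x y → x ≤ y
  chain⇒≤ pre nil = IsPreorder.refl pre
  chain⇒≤ pre (cons x⋖y c) = IsPreorder.trans pre (proj₁ (proj₁ x⋖y)) (chain⇒≤ pre c)

  snoc : ∀ {x y z} → Chain _≤_ x y → _⋖_ _≤_ y z → Chain _≤_ x z
  snoc nil e = cons e nil
  snoc (cons e' c) e = cons e' (snoc c e)

  data LastEdgeView {x : Fin n} : ∀ {y} → Chain _≤_ x y → Set where
    empty : LastEdgeView nil
    last  : ∀ {w y} (c : Chain _≤_ x w) (e : _⋖_ _≤_ w y) → LastEdgeView (snoc c e)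

  lastEdgeView : ∀ {x y} (c : Chain _≤_ x y) → LastEdgeView c
  lastEdgeView nil = empty
  lastEdgeView (cons e c) with lastEdgeView c
  ... | empty = last nil e
  ... | last c' e' = last (cons e c') e'

  EdgesIn : (Fin n → Fin n → Set) → ∀ {x y} → Chain _≤_ x y → Set
  EdgesIn D nil = ⊤
  EdgesIn D (cons {x} {y} _ c) = D x y × EdgesIn D c

  module _ {D : Fin n → Fin n → Set} where

    edgesIn-all : (∀ a b → _⋖_ _≤_ a b → D a b) → ∀ {x y} (c : Chain _≤_ x y) → EdgesIn D c
    edgesIn-all inD nil = tt
    edgesIn-all inD (cons e c) = inD _ _ e , edgesIn-all inD c

    edgesIn-mono : ∀ {D'} → (∀ {a b} → D a b → D' a b) →
      ∀ {x y} (c : Chain _≤_ x y) → EdgesIn D c → EdgesIn D' c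
    edgesIn-mono D⇒D' nil _ = tt
    edgesIn-mono D⇒D' (cons _ c) (d , ds) = D⇒D' d , edgesIn-mono D⇒D' c ds

    edgesIn-snoc : ∀ {x w y} (c : Chain _≤_ x w) (e : _⋖_ _≤_ w y) →
      EdgesIn D c → D w y → EdgesIn D (snoc c e)
    edgesIn-snoc nil e _ d = d , tt
    edgesIn-snoc (cons _ c) e (d' , ds) d = d' , edgesIn-snoc c e ds d

    edgesIn-unsnoc : ∀ {x w y} (c : Chain _≤_ x w) (e : _⋖_ _≤_ w y) →
      EdgesIn D (snoc c e) → EdgesIn D c × D w y
    edgesIn-unsnoc nil e (d , _) = tt , d
    edgesIn-unsnoc (cons _ c) e (d' , ds) =
      let (ds' , d) = edgesIn-unsnoc c e ds in (d' , ds') , d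

    edgesIn⇒linked : ∀ {x y} (c : Chain _≤_ x y) → EdgesIn D c → Linked D (vertices _≤_ c)
    edgesIn⇒linked nil _ = [-]
    edgesIn⇒linked (cons _ nil) (d , _) = d ∷ [-]
    edgesIn⇒linked (cons _ c@(cons _ _)) (d , ds) = d ∷ edgesIn⇒linked c ds

    linked⇒edgesIn : ∀ {x y} (c : Chain _≤_ x y) → Linked D (vertices _≤_ c) → EdgesIn D c
    linked⇒edgesIn nil _ = tt
    linked⇒edgesIn (cons _ nil) (d ∷ _) = d , tt
    linked⇒edgesIn (cons _ c@(cons _ _)) (d ∷ ds) = d , linked⇒edgesIn c ds

    edgesIn-transfer : ∀ {x y x' y'} (c : Chain _≤_ x y) (c' : Chain _≤_ x' y') →
      vertices _≤_ c ≡ vertices _≤_ c' → EdgesIn D c → EdgesIn D c'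
    edgesIn-transfer c c' same = linked⇒edgesIn c' ∘ subst (Linked D) same ∘ edgesIn⇒linked c

    edgesIn? : Decidable D → ∀ {x y} (c : Chain _≤_ x y) → Dec (EdgesIn D c)
    edgesIn? D? c = map′ (linked⇒edgesIn c) (edgesIn⇒linked c) (linked? D? (vertices _≤_ c))

  module _ (lab : Fin n → Fin n → ℤ) where
    private
      Rises : ∀ {x y} → Chain _≤_ x y → Set
      Rises = Rising _≤_ lab

    rising-tail : ∀ {x y z} (e : _⋖_ _≤_ x y) (c : Chain _≤_ y z) → Rises (cons e c) → Rises c
    rising-tail e nil _ = tt
    rising-tail e (cons _ _) (_ , r) = r

    rising-init : ∀ {x w y} (c : Chain _≤_ x w) (e : _⋖_ _≤_ w y) → Rises (snoc c e) → Rises c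
    rising-init nil e _ = tt
    rising-init (cons _ nil) e _ = tt
    rising-init (cons _ c@(cons _ _)) e (le , r) = le , rising-init c e r

    rising-snoc : ∀ {x w y} (c : Chain _≤_ x w) (e : _⋖_ _≤_ w y) → Rises c →
      EdgesIn (λ a b → lab a b ≤ℤ lab w y) c → Rises (snoc c e)
    rising-snoc nil e _ _ = tt
    rising-snoc (cons _ nil) e _ (le , _) = le , tt
    rising-snoc (cons _ c@(cons _ _)) e (le , r) (_ , les) = le , rising-snoc c e r les

module Reachability {n : ℕ} (_≤_ : Rel (Fin n) 0ℓ) (po : IsPartialOrder _≡_ _≤_)
    (_≤?_ : Decidable _≤_) (lab : Fin n → Fin n → ℤ) (U : IsULabeling _≤_ lab) where
  open Chains _≤_
  open import Data.List.Membership.DecPropositional (≡-dec (_≟_ {n}) (_≟_ {n})) using (_∈?_)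

  InList : List (Edge n) → Fin n → Fin n → Set
  InList es a b = (a , b) ∈ es

  Reach : List (Edge n) → Fin n → Fin n → Set
  Reach done x y = Σ (Chain _≤_ x y) λ c → Rising _≤_ lab c × EdgesIn (InList done) c

  reach⇒≤ : ∀ {done x y} → Reach done x y → x ≤ y
  reach⇒≤ (c , _) = chain⇒≤ (IsPartialOrder.isPreorder po) c

  rising-unique : ∀ {x y} (c c' : Chain _≤_ x y) → Rising _≤_ lab c → Rising _≤_ lab c' →
    vertices _≤_ c ≡ vertices _≤_ c'
  rising-unique {x} {y} c c' rc rc' =
    let (_ , _ , unique) = U x y (chain⇒≤ (IsPartialOrder.isPreorder po) c)
    in trans (unique c rc) (sym (unique c' rc'))

  -- decided via the unique rising chain from x to y, if x ≤ y
  reach? : ∀ done x y → Dec (Reach done x y)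
  reach? done x y with x ≤? y
  ... | no x≰y = no (x≰y ∘ reach⇒≤)
  ... | yes x≤y =
    let (c , rc , unique) = U x y x≤y
    in map′ (λ inDone → c , rc , inDone)
            (λ (c' , rc' , inDone') → edgesIn-transfer c' c (unique c' rc') inDone')
            (edgesIn? (λ a b → (a , b) ∈? done) c)

  reach-nothing : ∀ {x y} → Reach [] x y → x ≡ y
  reach-nothing (nil , _) = refl
  reach-nothing (cons _ _ , _ , (() , _))

  reach-everything : ∀ {done} → (∀ a b → _⋖_ _≤_ a b → (a , b) ∈ done) →
    ∀ {x y} → x ≤ y → Reach done x y
  reach-everything complete {x} {y} x≤y =
    let (c , rc , _) = U x y x≤y in c , rc , edgesIn-all complete c

  module AddTopEdge (done : List (Edge n)) {u v : Fin n} (u⋖v : _⋖_ _≤_ u v)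
      (below : ∀ {a b} → (a , b) ∈ done → lab a b <ℤ lab u v) where

    done' : List (Edge n)
    done' = (u , v) ∷ done

    -- u ⋖ v can only be the last edge of a rising chain through done';
    -- so a rising chain through done' not ending at v avoids u ⋖ v
    avoids-top : ∀ {x y} (c : Chain _≤_ x y) → Rising _≤_ lab c →
      EdgesIn (InList done') c → y ≢ v → EdgesIn (InList done) c
    avoids-top nil _ _ _ = tt
    avoids-top (cons e c) rc (there m , ds) y≢v = m , avoids-top c (rising-tail lab e c rc) ds y≢v
    avoids-top (cons e nil) _ (here refl , _) y≢v = ⊥-elim (y≢v refl)
    avoids-top (cons e (cons _ _)) (le , _) (here refl , there m , _) _ =
      ⊥-elim (ℤ.<⇒≱ (below m) le)
    avoids-top (cons e (cons _ _)) _ (here refl , here v,w≡u,v , _) _ =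
      ⊥-elim (⋖⇒≢ u⋖v (sym (cong proj₁ v,w≡u,v)))

    reach-mono : ∀ {x y} → Reach done x y → Reach done' x y
    reach-mono (c , rc , ds) = c , rc , edgesIn-mono there c ds

    reach-extend : ∀ {x} → Reach done x u → Reach done' x v
    reach-extend (c , rc , ds) =
      snoc c u⋖v ,
      rising-snoc lab c u⋖v rc (edgesIn-mono (ℤ.<⇒≤ ∘ below) c ds) ,
      edgesIn-snoc c u⋖v (edgesIn-mono there c ds) (here refl)

    reach-away : ∀ {x y} → y ≢ v → Reach done' x y → Reach done x y
    reach-away y≢v (c , rc , ds) = c , rc , avoids-top c rc ds y≢v

    reach-at-top : ∀ {x} → Reach done' x v → Reach done x v ⊎ Reach done x u
    reach-at-top (c , rc , ds) with lastEdgeView c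
    ... | empty = inj₁ (nil , tt , tt)
    ... | last c' w⋖v with edgesIn-unsnoc c' w⋖v ds
    ...   | ds' , here refl =
      inj₂ (c' , rising-init lab c' w⋖v rc , avoids-top c' (rising-init lab c' w⋖v rc) ds' (⋖⇒≢ w⋖v))
    ...   | ds' , there m =
      inj₁ (snoc c' w⋖v , rc ,
            edgesIn-snoc c' w⋖v (avoids-top c' (rising-init lab c' w⋖v rc) ds' (⋖⇒≢ w⋖v)) m)

    -- ... and these two kinds are disjoint: a chain to v through u uses the
    -- top edge, hence so does the unique rising chain to v
    reach-disjoint : ∀ {x} → Reach done x u → ¬ Reach done x v
    reach-disjoint ru (c , rc , ds) =
      let (c⁺ , rc⁺ , _) = reach-extend ru
          (_ , top∈done) = edgesIn-unsnoc (proj₁ ru) u⋖v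
                             (edgesIn-transfer c c⁺ (rising-unique c c⁺ rc rc⁺) ds)
      in ℤ.<-irrefl refl (below top∈done)

module Zeta {c ℓ : Level} (A : AbelianGroup c ℓ) {n : ℕ}
    (_≤_ : Rel (Fin n) 0ℓ) (po : IsPartialOrder _≡_ _≤_) (_≤?_ : Decidable _≤_)
    (lab : Fin n → Fin n → ℤ) (U : IsULabeling _≤_ lab) where
  open AbelianGroup A renaming (refl to ≈-refl; sym to ≈-sym; trans to ≈-trans)
  open IndicatorSums commutativeMonoid
  open Reachability _≤_ po _≤?_ lab U
  open import Relation.Binary.Reasoning.Setoid setoid

  LabelBelow : Edge n → Edge n → Set
  LabelBelow (a , b) (a' , b') = lab a b <ℤ lab a' b'

  module _ (f : Fin n → Carrier) where

    Tracks : List (Edge n) → (Fin n → Carrier) → Set ℓ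
    Tracks done g = ∀ y → g y ≈ ∑[ x < n ] [ reach? done x y ]· f x

    tracks-start : Tracks [] f
    tracks-start y = ≈-sym (≈-trans (sum-concentrated _ y off-y) (indicator-yes (reach? [] y y) (nil , tt , tt)))
      where
      off-y : ∀ x → x ≢ y → [ reach? [] x y ]· f x ≈ ε
      off-y x x≢y = indicator-no (reach? [] x y) (x≢y ∘ reach-nothing)

    tracks-step : ∀ {done u v g} (u⋖v : _⋖_ _≤_ u v) →
      (below : ∀ {a b} → (a , b) ∈ done → lab a b <ℤ lab u v) →
      Tracks done g → Tracks ((u , v) ∷ done) (zetaStep A g (u , v))
    tracks-step {done} {u} {v} {g} u⋖v below tracks y with y ≟ v
    ... | yes refl = begin
      g v ∙ g u                                                 ≈⟨ ∙-cong (tracks v) (tracks u) ⟩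
      ∑[ x < n ] [ reach? done x v ]· f x ∙ ∑[ x < n ] [ reach? done x u ]· f x
                                                                ≈⟨ ≈-sym (∑-distrib-+ {n} _ _) ⟩
      ∑[ x < n ] ([ reach? done x v ]· f x ∙ [ reach? done x u ]· f x)
                                                                ≈⟨ sum-cong-≋ (λ x → ≈-sym (split x)) ⟩
      ∑[ x < n ] [ reach? done' x v ]· f x                      ∎
      where
      open AddTopEdge done u⋖v below
      split : ∀ x → [ reach? done' x v ]· f x ≈ [ reach? done x v ]· f x ∙ [ reach? done x u ]· f x
      split x = indicator-disjoint (reach? done' x v) (reach? done x v) (reach? done x u)
        reach-at-top [ reach-mono , reach-extend ] reach-disjoint
    ... | no y≢v = ≈-trans (tracks y) (sum-cong-≋ λ x →
      indicator-cong (reach? done x y) (reach? ((u , v) ∷ done) x y) reach-mono (reach-away y≢v))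
      where open AddTopEdge done u⋖v below

    tracks-run : ∀ R {done g} → Tracks done g →
      All (λ (a , b) → _⋖_ _≤_ a b) R → AllPairs LabelBelow R →
      (∀ {d e} → d ∈ done → e ∈ R → LabelBelow d e) →
      Tracks (R ʳ++ done) (foldl (zetaStep A) g R)
    tracks-run [] tracks _ _ _ = tracks
    tracks-run ((u , v) ∷ R) {done} tracks (u⋖v ∷ covers) (above ∷ increasing) separated =
      tracks-run R (tracks-step u⋖v (λ m → separated m (here refl)) tracks) covers increasing separated'
      where
      separated' : ∀ {d e} → d ∈ (u , v) ∷ done → e ∈ R → LabelBelow d e
      separated' (here refl) e∈R = All.lookup above e∈R
      separated' (there d∈done) e∈R = separated d∈done (there e∈R)

    zeta-theorem : ∀ es → IsEdgeOrder _≤_ lab es → ∀ y → zetaProgram A es f y ≈ sumBelow A _≤?_ f y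
    zeta-theorem es (edges , complete , increasing) y = begin
      zetaProgram A es f y                     ≈⟨ tracks y ⟩
      ∑[ x < n ] [ reach? (es ʳ++ []) x y ]· f x
                                               ≈⟨ sum-cong-≋ (λ x → indicator-cong (reach? _ x y) (x ≤? y)
                                                     reach⇒≤ (reach-everything complete')) ⟩
      ∑[ x < n ] [ x ≤? y ]· f x               ≈⟨ ≈-sym (filtered-fold (_≤? y) f id) ⟩
      sumBelow A _≤?_ f y                      ∎
      where
      tracks : Tracks (es ʳ++ []) (zetaProgram A es f)
      tracks = tracks-run es tracks-start (All.tabulate edges)
        (Linked⇒AllPairs ℤ.<-trans increasing) (λ ())
      complete' : ∀ a b → _⋖_ _≤_ a b → (a , b) ∈ es ʳ++ []
      complete' a b a⋖b = reverseAcc⁺ [] es (inj₂ (complete a b a⋖b))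

module MobiusInversion {c ℓ : Level} (A : AbelianGroup c ℓ) {n : ℕ} where
  open AbelianGroup A renaming (refl to ≈-refl; sym to ≈-sym; trans to ≈-trans)
  open import Relation.Binary.Reasoning.Setoid setoid

  zetaStep-cong : ∀ {h h' : Fin n → Carrier} e → (∀ y → h y ≈ h' y) →
    ∀ y → zetaStep A h e y ≈ zetaStep A h' e y
  zetaStep-cong (x , y) h≈h' z with z ≟ y
  ... | yes _ = ∙-cong (h≈h' y) (h≈h' x)
  ... | no _ = h≈h' z

  zetaProgram-cong : ∀ es {h h' : Fin n → Carrier} → (∀ y → h y ≈ h' y) →
    ∀ y → zetaProgram A es h y ≈ zetaProgram A es h' y
  zetaProgram-cong [] h≈h' = h≈h'
  zetaProgram-cong (e ∷ es) h≈h' = zetaProgram-cong es (zetaStep-cong e h≈h')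

  zetaStep-target : ∀ (h : Fin n → Carrier) x y → zetaStep A h (x , y) y ≡ h y ∙ h x
  zetaStep-target h x y rewrite dec-true (y ≟ y) refl = refl

  zetaStep-elsewhere : ∀ (h : Fin n → Carrier) x y {z} → z ≢ y → zetaStep A h (x , y) z ≡ h z
  zetaStep-elsewhere h x y {z} z≢y rewrite dec-false (z ≟ y) z≢y = refl

  mobiusStep-target : ∀ (h : Fin n → Carrier) x y → mobiusStep A h (x , y) y ≡ h y ∙ h x ⁻¹
  mobiusStep-target h x y rewrite dec-true (y ≟ y) refl = refl

  mobiusStep-elsewhere : ∀ (h : Fin n → Carrier) x y {z} → z ≢ y → mobiusStep A h (x , y) z ≡ h z
  mobiusStep-elsewhere h x y {z} z≢y rewrite dec-false (z ≟ y) z≢y = refl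

  zetaStep-undoes-mobiusStep : ∀ (h : Fin n → Carrier) x y → x ≢ y →
    ∀ z → zetaStep A (mobiusStep A h (x , y)) (x , y) z ≈ h z
  zetaStep-undoes-mobiusStep h x y x≢y z = by-cases (z ≟ y)
    where
    h⁻ : Fin n → Carrier
    h⁻ = mobiusStep A h (x , y)

    by-cases : Dec (z ≡ y) → zetaStep A h⁻ (x , y) z ≈ h z
    by-cases (no z≢y) = reflexive (trans (zetaStep-elsewhere h⁻ x y z≢y) (mobiusStep-elsewhere h x y z≢y))
    by-cases (yes refl) = begin
      zetaStep A h⁻ (x , z) z   ≡⟨ zetaStep-target h⁻ x z ⟩
      h⁻ z ∙ h⁻ x               ≡⟨ cong₂ _∙_ (mobiusStep-target h x z) (mobiusStep-elsewhere h x z x≢y) ⟩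
      h z ∙ h x ⁻¹ ∙ h x        ≈⟨ assoc _ _ _ ⟩
      h z ∙ (h x ⁻¹ ∙ h x)      ≈⟨ ∙-congˡ (inverseˡ _) ⟩
      h z ∙ ε                   ≈⟨ identityʳ _ ⟩
      h z                       ∎

  zeta-undoes-mobius : ∀ (es : List (Edge n)) → All (λ (x , y) → x ≢ y) es →
    ∀ g y → zetaProgram A es (mobiusProgram A es g) y ≈ g y
  zeta-undoes-mobius es distinct g y = begin
    zetaProgram A es (mobiusProgram A es g) y ≡⟨ cong (λ h → zetaProgram A es h y) (foldl-ʳ++ (mobiusStep A) g es) ⟩
    zetaProgram A es (unwind es) y            ≈⟨ undo es distinct y ⟩
    g y                                       ∎
    where
    -- the Möbius program, applying the last edge first
    unwind : List (Edge n) → Fin n → Carrier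
    unwind = foldr (λ e h → mobiusStep A h e) g

    undo : ∀ es → All (λ (x , y) → x ≢ y) es → ∀ y → zetaProgram A es (unwind es) y ≈ g y
    undo [] _ _ = ≈-refl
    undo ((x , y) ∷ es) (x≢y ∷ distinct) z =
      ≈-trans (zetaProgram-cong es (zetaStep-undoes-mobiusStep (unwind es) x y x≢y) z) (undo es distinct z)

proposition1 : ∀ {c ℓ : Level} (A : AbelianGroup c ℓ) (n : ℕ)
    (_≤_ : Rel (Fin n) Level.zero) → IsPartialOrder _≡_ _≤_ → (_≤?_ : Decidable _≤_)
    (lab : Fin n → Fin n → ℤ) → InjectiveOnEdges _≤_ lab → IsULabeling _≤_ lab →
    (es : List (Fin n × Fin n)) → IsEdgeOrder _≤_ lab es →
    ((f : Fin n → AbelianGroup.Carrier A) → (y : Fin n) →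
      AbelianGroup._≈_ A (zetaProgram A es f y) (sumBelow A _≤?_ f y))
    × ((g : Fin n → AbelianGroup.Carrier A) → (y : Fin n) →
      AbelianGroup._≈_ A (g y) (sumBelow A _≤?_ (mobiusProgram A es g) y))
proposition1 A n _≤_ po _≤?_ lab _ U es order@(edges , _) =
  (λ f → zeta-theorem f es order) ,
  (λ g y → ≈-trans (≈-sym (zeta-undoes-mobius es distinct g y))
                   (zeta-theorem (mobiusProgram A es g) es order y))
  where
  open AbelianGroup A using () renaming (sym to ≈-sym; trans to ≈-trans)
  open Zeta A _≤_ po _≤?_ lab U using (zeta-theorem)
  open MobiusInversion A using (zeta-undoes-mobius)
  open Chains _≤_ using (⋖⇒≢)

  distinct : All (λ (x , y) → x ≢ y) es
  distinct = All.tabulate (⋖⇒≢ ∘ edges)
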